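{- Let $g,\tilde g$ be formal variables and let $R\in\mathbb{Q}[[g,\tilde g]]$ be the unique formal power series with $R=1+O(g\tilde g)$ satisfying $R=1+2g\tilde g R^2$. Let $x\in\mathbb{Q}[[g,\tilde g]]$ be the unique formal power series with zero constant term satisfying $x=g\tilde g R(1+x)^2$ (equivalently $1-g\tilde gR\left(x+\frac1x+2\right)=0$). For integers $n\ge -1$ define $$R_n=R\,\frac{(1-x^{n+1})(1-x^{n+5})}{(1-x^{n+2})(1-x^{n+4})},$$ so that $R_{ -1}=0$. Then for all $n\ge 0$, $$R_n=1+g\tilde g\,R_n\,(R_{n+1}+R_{n-1}).$$
   Context: All identities are identities of formal power series; the quotients are well defined since $1-x^k$ is invertible for $k\ge1$. Combinatorially, $R_n$ is the generating function of planar bipartite (black/white vertex-colored) trivalent graphs with two legs, the incoming leg attached to a white vertex and the outgoing one to a black vertex, with weights $g$ per black and $\tilde g$ per white vertex, and with geodesic distance between the legs at most $n$. -}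

module Defs where

open import Data.Nat as ℕ using (ℕ; zero; suc; _∸_)
open import Data.Rational as ℚ using (ℚ; 0ℚ; 1ℚ)
open import Relation.Binary.PropositionalEquality using (_≡_)

-- Formal power series in two commuting variables g, g̃ over ℚ,
-- represented by their coefficients: (f i j) is the coefficient of g^i g̃^j.
Series : Set
Series = ℕ → ℕ → ℚ

infix 4 _≋_
_≋_ : Series → Series → Set
f ≋ h = ∀ i j → f i j ≡ h i j

sumTo : ℕ → (ℕ → ℚ) → ℚ
sumTo zero    a = a 0
sumTo (suc n) a = sumTo n a ℚ.+ a (suc n)

const : ℚ → Series
const c zero    zero    = c
const c _       _       = 0ℚ

𝟘 𝟙 : Series
𝟘 = const 0ℚ
𝟙 = const 1ℚ

ggt : Series
ggt 1 1 = 1ℚ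
ggt _ _ = 0ℚ

infixl 6 _⊕_ _⊖_
infixl 7 _⊛_

_⊕_ : Series → Series → Series
(f ⊕ h) i j = f i j ℚ.+ h i j

_⊖_ : Series → Series → Series
(f ⊖ h) i j = f i j ℚ.- h i j

_⊛_ : Series → Series → Series
(f ⊛ h) i j = sumTo i (λ a → sumTo j (λ b → f a b ℚ.* h (i ∸ a) (j ∸ b)))

_^ₛ_ : Series → ℕ → Series
f ^ₛ zero  = 𝟙
f ^ₛ suc k = f ⊛ (f ^ₛ k)

-- (1 - y)^{-1} = Σ_m y^m, for y with zero constant term.
-- The coefficient of g^i g̃^j only receives contributions from m ≤ i + j,
-- so the truncated sum is the exact coefficient.
invOneMinus : Series → Series
invOneMinus y i j = sumTo (i ℕ.+ j) (λ m → (y ^ₛ m) i j)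

-- For a natural number a, the series
--   R (1 - x^a)(1 - x^(a+4)) / ((1 - x^(a+1))(1 - x^(a+3))),
-- i.e.  R_{a-1}  in the paper's notation (so Rsh R x 0 = R_{-1}).
Rsh : Series → Series → ℕ → Series
Rsh R x a =
  R ⊛ (𝟙 ⊖ x ^ₛ a) ⊛ (𝟙 ⊖ x ^ₛ (a ℕ.+ 4))
    ⊛ invOneMinus (x ^ₛ (a ℕ.+ 1)) ⊛ invOneMinus (x ^ₛ (a ℕ.+ 3))

two : ℚ
two = 1ℚ ℚ.+ 1ℚ

-- Write z = x^n and p k = 1 - z x^k.  Then R_{n-1}, R_n, R_{n+1} are the ratios
-- R p0 p4 / (p1 p3), R p1 p5 / (p2 p4), R p2 p6 / (p3 p5).  Using 1 = R - 2 g g̃ R²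
-- and g g̃ R = x / (1 + x)², and clearing the denominator (1 + x)² p1 p2 p3 p4 p5,
-- the recursion becomes a polynomial identity in x and z alone (keyPolynomial≈0).
-- The denominators are units of ℚ[[g, g̃]] because x has no constant term, so that
-- 1 - x^k is inverted by the geometric series.  The power series ring itself is
-- obtained by iterating the one-variable construction: ℚ[[g, g̃]] = ℚ[[g]][[g̃]].
module Submission where

open import Defs
open import Data.Nat using (ℕ; suc)
open import Data.Rational using (0ℚ; 1ℚ)
open import Relation.Binary.PropositionalEquality using (_≡_)

open import Algebra using (CommutativeRing; Semiring; Op₂)
import Algebra.Construct.Pointwise ℕ as Pointwise
import Algebra.Solver.Ring
import Algebra.Solver.Ring.AlmostCommutativeRing as ACR
open import Data.Integer as ℤ using (ℤ; +_; -[1+_]; +0; +[1+_]; pred) renaming (suc to sucℤ)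
import Data.Integer.Properties as ℤ
open import Data.Maybe using (Maybe; just; nothing)
open import Data.Nat as ℕ using (zero; _∸_; _≤_; _<_; z≤n; s≤s)
import Data.Nat.Properties as ℕ
open import Data.Product using (_,_)
import Data.Rational as ℚ
import Data.Rational.Properties as ℚ
open import Data.Sum using (inj₁; inj₂)
open import Function using (_∘_)
open import Level using (0ℓ; _⊔_)
import Relation.Binary.PropositionalEquality as ≡
open import Relation.Nullary using (yes; no)

-- The solver of Algebra.Solver.Ring for an arbitrary commutative ring, with integer
-- coefficients (the library only provides natural-number coefficients, which cannot
-- express subtraction).
module RingSolver {c ℓ} (𝓡 : CommutativeRing c ℓ) where
  open CommutativeRing 𝓡 hiding (zero)
  open import Algebra.Properties.Monoid.Mult.TCOptimised +-monoid using (_×_; 1+×)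
  open import Algebra.Properties.Ring ring using (-‿distribˡ-*; -‿involutive)
  open import Algebra.Properties.Group +-group using (ε⁻¹≈ε)
  open import Algebra.Properties.AbelianGroup +-abelianGroup using (⁻¹-∙-comm)
  open import Relation.Binary.Reasoning.Setoid setoid

  ⟦_⟧ : ℤ → Carrier
  ⟦ + n ⟧ = n × 1#
  ⟦ -[1+ n ] ⟧ = - (suc n × 1#)

  private
    ⟦cong⟧ : ∀ {i j} → i ≡ j → ⟦ i ⟧ ≈ ⟦ j ⟧
    ⟦cong⟧ = reflexive ∘ ≡.cong ⟦_⟧

    1+-[1+a]≈-a : ∀ a → 1# + - (1# + a) ≈ - a
    1+-[1+a]≈-a a = begin
      1# + - (1# + a)    ≈⟨ +-congˡ (⁻¹-∙-comm 1# a) ⟨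
      1# + (- 1# + - a)  ≈⟨ +-assoc 1# (- 1#) (- a) ⟨
      (1# + - 1#) + - a  ≈⟨ +-congʳ (-‿inverseʳ 1#) ⟩
      0# + - a           ≈⟨ +-identityˡ (- a) ⟩
      - a                ∎

    -1+[1+a]≈a : ∀ a → - 1# + (1# + a) ≈ a
    -1+[1+a]≈a a = begin
      - 1# + (1# + a)  ≈⟨ +-assoc (- 1#) 1# a ⟨
      (- 1# + 1#) + a  ≈⟨ +-congʳ (-‿inverseˡ 1#) ⟩
      0# + a           ≈⟨ +-identityˡ a ⟩
      a                ∎

    ⟦suc⟧ : ∀ i → ⟦ sucℤ i ⟧ ≈ 1# + ⟦ i ⟧
    ⟦suc⟧ (+ n) = 1+× n 1#
    ⟦suc⟧ -[1+ zero ] = sym (-‿inverseʳ 1#)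
    ⟦suc⟧ -[1+ suc n ] = sym (trans (+-congˡ (-‿cong (1+× (suc n) 1#))) (1+-[1+a]≈-a (suc n × 1#)))

    ⟦pred⟧ : ∀ i → ⟦ pred i ⟧ ≈ - 1# + ⟦ i ⟧
    ⟦pred⟧ +0 = sym (+-identityʳ (- 1#))
    ⟦pred⟧ +[1+ n ] = sym (trans (+-congˡ (1+× n 1#)) (-1+[1+a]≈a (n × 1#)))
    ⟦pred⟧ -[1+ n ] = trans (-‿cong (1+× (suc n) 1#)) (sym (⁻¹-∙-comm 1# (suc n × 1#)))

    ⟦+⟧ : ∀ i j → ⟦ i ℤ.+ j ⟧ ≈ ⟦ i ⟧ + ⟦ j ⟧
    ⟦+⟧ +0 j = trans (⟦cong⟧ (ℤ.+-identityˡ j)) (sym (+-identityˡ ⟦ j ⟧))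
    ⟦+⟧ +[1+ m ] j = begin
      ⟦ +[1+ m ] ℤ.+ j ⟧       ≈⟨ ⟦cong⟧ (ℤ.suc-+ m j) ⟩
      ⟦ sucℤ (+ m ℤ.+ j) ⟧     ≈⟨ ⟦suc⟧ (+ m ℤ.+ j) ⟩
      1# + ⟦ + m ℤ.+ j ⟧       ≈⟨ +-congˡ (⟦+⟧ (+ m) j) ⟩
      1# + (⟦ + m ⟧ + ⟦ j ⟧)   ≈⟨ +-assoc 1# ⟦ + m ⟧ ⟦ j ⟧ ⟨
      (1# + ⟦ + m ⟧) + ⟦ j ⟧   ≈⟨ +-congʳ (1+× m 1#) ⟨
      ⟦ +[1+ m ] ⟧ + ⟦ j ⟧     ∎
    ⟦+⟧ -[1+ zero ] j = begin
      ⟦ pred +0 ℤ.+ j ⟧        ≈⟨ ⟦cong⟧ (ℤ.pred-+ +0 j) ⟩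
      ⟦ pred (+0 ℤ.+ j) ⟧      ≈⟨ ⟦pred⟧ (+0 ℤ.+ j) ⟩
      - 1# + ⟦ +0 ℤ.+ j ⟧      ≈⟨ +-congˡ (⟦cong⟧ (ℤ.+-identityˡ j)) ⟩
      ⟦ -[1+ zero ] ⟧ + ⟦ j ⟧  ∎
    ⟦+⟧ -[1+ suc m ] j = begin
      ⟦ pred -[1+ m ] ℤ.+ j ⟧         ≈⟨ ⟦cong⟧ (ℤ.pred-+ -[1+ m ] j) ⟩
      ⟦ pred (-[1+ m ] ℤ.+ j) ⟧       ≈⟨ ⟦pred⟧ (-[1+ m ] ℤ.+ j) ⟩
      - 1# + ⟦ -[1+ m ] ℤ.+ j ⟧       ≈⟨ +-congˡ (⟦+⟧ -[1+ m ] j) ⟩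
      - 1# + (⟦ -[1+ m ] ⟧ + ⟦ j ⟧)   ≈⟨ +-assoc (- 1#) ⟦ -[1+ m ] ⟧ ⟦ j ⟧ ⟨
      (- 1# + ⟦ -[1+ m ] ⟧) + ⟦ j ⟧   ≈⟨ +-congʳ (⁻¹-∙-comm 1# (suc m × 1#)) ⟩
      - (1# + suc m × 1#) + ⟦ j ⟧     ≈⟨ +-congʳ (-‿cong (1+× (suc m) 1#)) ⟨
      ⟦ -[1+ suc m ] ⟧ + ⟦ j ⟧        ∎

    ⟦-⟧ : ∀ i → ⟦ ℤ.- i ⟧ ≈ - ⟦ i ⟧
    ⟦-⟧ +0 = sym ε⁻¹≈ε
    ⟦-⟧ +[1+ n ] = refl
    ⟦-⟧ -[1+ n ] = sym (-‿involutive ⟦ +[1+ n ] ⟧)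

    ⟦+*⟧ : ∀ m j → ⟦ + m ℤ.* j ⟧ ≈ ⟦ + m ⟧ * ⟦ j ⟧
    ⟦+*⟧ zero j = trans (⟦cong⟧ (ℤ.*-zeroˡ j)) (sym (zeroˡ ⟦ j ⟧))
    ⟦+*⟧ (suc m) j = begin
      ⟦ sucℤ (+ m) ℤ.* j ⟧              ≈⟨ ⟦cong⟧ (ℤ.suc-* (+ m) j) ⟩
      ⟦ j ℤ.+ + m ℤ.* j ⟧               ≈⟨ ⟦+⟧ j (+ m ℤ.* j) ⟩
      ⟦ j ⟧ + ⟦ + m ℤ.* j ⟧             ≈⟨ +-congˡ (⟦+*⟧ m j) ⟩
      ⟦ j ⟧ + ⟦ + m ⟧ * ⟦ j ⟧           ≈⟨ +-congʳ (*-identityˡ ⟦ j ⟧) ⟨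
      1# * ⟦ j ⟧ + ⟦ + m ⟧ * ⟦ j ⟧      ≈⟨ distribʳ ⟦ j ⟧ 1# ⟦ + m ⟧ ⟨
      (1# + ⟦ + m ⟧) * ⟦ j ⟧            ≈⟨ *-congʳ (1+× m 1#) ⟨
      ⟦ + suc m ⟧ * ⟦ j ⟧               ∎

    ⟦*⟧ : ∀ i j → ⟦ i ℤ.* j ⟧ ≈ ⟦ i ⟧ * ⟦ j ⟧
    ⟦*⟧ (+ m) j = ⟦+*⟧ m j
    ⟦*⟧ -[1+ m ] j = begin
      ⟦ -[1+ m ] ℤ.* j ⟧            ≈⟨ ⟦cong⟧ (ℤ.neg-distribˡ-* +[1+ m ] j) ⟨
      ⟦ ℤ.- (+[1+ m ] ℤ.* j) ⟧      ≈⟨ ⟦-⟧ (+[1+ m ] ℤ.* j) ⟩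
      - ⟦ +[1+ m ] ℤ.* j ⟧          ≈⟨ -‿cong (⟦+*⟧ (suc m) j) ⟩
      - (⟦ +[1+ m ] ⟧ * ⟦ j ⟧)      ≈⟨ -‿distribˡ-* ⟦ +[1+ m ] ⟧ ⟦ j ⟧ ⟩
      ⟦ -[1+ m ] ⟧ * ⟦ j ⟧          ∎

    homomorphism : ℤ.+-*-rawRing ACR.-Raw-AlmostCommutative⟶ ACR.fromCommutativeRing 𝓡
    homomorphism = record
      { ⟦_⟧ = ⟦_⟧ ; +-homo = ⟦+⟧ ; *-homo = ⟦*⟧ ; -‿homo = ⟦-⟧ ; 0-homo = refl ; 1-homo = refl }

    ⟦≟⟧ : ∀ i j → Maybe (⟦ i ⟧ ≈ ⟦ j ⟧)
    ⟦≟⟧ i j with i ℤ.≟ j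
    ... | yes ≡.refl = just refl
    ... | no _ = nothing

  open Algebra.Solver.Ring ℤ.+-*-rawRing (ACR.fromCommutativeRing 𝓡) homomorphism ⟦≟⟧ public
    using (solve; _:=_; con; _:+_; _:*_; _:-_; _:^_)

module Sum {c ℓ} (𝓡 : CommutativeRing c ℓ) where
  open CommutativeRing 𝓡 hiding (zero)
  open RingSolver 𝓡
  open import Algebra.Definitions.RawSemiring (Semiring.rawSemiring semiring) using (_^_)
  open import Algebra.Properties.CommutativeSemigroup +-commutativeSemigroup using (interchange)
  open import Relation.Binary.Reasoning.Setoid setoid

  Σ≤ : ℕ → (ℕ → Carrier) → Carrier
  Σ≤ zero f = f 0
  Σ≤ (suc n) f = Σ≤ n f + f (suc n)

  Σ≤-cong : ∀ n {f g} → (∀ k → k ≤ n → f k ≈ g k) → Σ≤ n f ≈ Σ≤ n g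
  Σ≤-cong zero f≈g = f≈g 0 z≤n
  Σ≤-cong (suc n) f≈g = +-cong (Σ≤-cong n (λ k k≤n → f≈g k (ℕ.m≤n⇒m≤1+n k≤n))) (f≈g (suc n) ℕ.≤-refl)

  Σ≤-congʳ : ∀ {m n} f → m ≡ n → Σ≤ m f ≈ Σ≤ n f
  Σ≤-congʳ f ≡.refl = refl

  Σ≤-zero : ∀ n {f} → (∀ k → k ≤ n → f k ≈ 0#) → Σ≤ n f ≈ 0#
  Σ≤-zero zero f≈0 = f≈0 0 z≤n
  Σ≤-zero (suc n) f≈0 =
    trans (+-cong (Σ≤-zero n (λ k k≤n → f≈0 k (ℕ.m≤n⇒m≤1+n k≤n))) (f≈0 (suc n) ℕ.≤-refl)) (+-identityʳ 0#)

  Σ≤-extend : ∀ {m} n {f} → m ≤ n → (∀ k → m < k → k ≤ n → f k ≈ 0#) → Σ≤ n f ≈ Σ≤ m f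
  Σ≤-extend zero z≤n _ = refl
  Σ≤-extend (suc n) m≤1+n f≈0 with ℕ.m≤n⇒m<n∨m≡n m≤1+n
  ... | inj₁ (s≤s m≤n) = trans
    (+-cong (Σ≤-extend n m≤n (λ k m<k k≤n → f≈0 k m<k (ℕ.m≤n⇒m≤1+n k≤n))) (f≈0 (suc n) (s≤s m≤n) ℕ.≤-refl))
    (+-identityʳ _)
  ... | inj₂ ≡.refl = refl

  Σ≤-+ : ∀ n f g → Σ≤ n (λ k → f k + g k) ≈ Σ≤ n f + Σ≤ n g
  Σ≤-+ zero f g = refl
  Σ≤-+ (suc n) f g = trans (+-congʳ (Σ≤-+ n f g)) (interchange _ _ _ _)

  Σ≤-*ˡ : ∀ n a f → a * Σ≤ n f ≈ Σ≤ n (λ k → a * f k)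
  Σ≤-*ˡ zero a f = refl
  Σ≤-*ˡ (suc n) a f = trans (distribˡ a _ _) (+-congʳ (Σ≤-*ˡ n a f))

  Σ≤-*ʳ : ∀ n a f → Σ≤ n f * a ≈ Σ≤ n (λ k → f k * a)
  Σ≤-*ʳ zero a f = refl
  Σ≤-*ʳ (suc n) a f = trans (distribʳ a _ _) (+-congʳ (Σ≤-*ʳ n a f))

  Σ≤-suc : ∀ n f → Σ≤ (suc n) f ≈ f 0 + Σ≤ n (f ∘ suc)
  Σ≤-suc zero f = refl
  Σ≤-suc (suc n) f = trans (+-congʳ (Σ≤-suc n f)) (+-assoc _ _ _)

  Σ≤-reverse : ∀ n f → Σ≤ n f ≈ Σ≤ n (λ k → f (n ∸ k))
  Σ≤-reverse zero f = refl
  Σ≤-reverse (suc n) f = begin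
    Σ≤ (suc n) f                              ≈⟨ Σ≤-suc n f ⟩
    f 0 + Σ≤ n (f ∘ suc)                      ≈⟨ +-comm _ _ ⟩
    Σ≤ n (f ∘ suc) + f 0
      ≈⟨ +-cong (Σ≤-reverse n (f ∘ suc)) (reflexive (≡.cong f (≡.sym (ℕ.n∸n≡0 n)))) ⟩
    Σ≤ n (λ k → f (suc (n ∸ k))) + f (n ∸ n)
      ≈⟨ +-congʳ (Σ≤-cong n (λ k k≤n → reflexive (≡.cong f (≡.sym (ℕ.+-∸-assoc 1 k≤n))))) ⟩
    Σ≤ n (λ k → f (suc n ∸ k)) + f (n ∸ n)    ∎

  Σ≤-triangle : ∀ n (t : ℕ → ℕ → Carrier) →
    Σ≤ n (λ d → Σ≤ d (λ a → t a d)) ≈ Σ≤ n (λ a → Σ≤ (n ∸ a) (λ b → t a (a ℕ.+ b)))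
  Σ≤-triangle zero t = refl
  Σ≤-triangle (suc n) t = begin
    Σ≤ n (λ d → Σ≤ d (λ a → t a d)) + Σ≤ (suc n) (λ a → t a (suc n))
      ≈⟨ +-congʳ (Σ≤-triangle n t) ⟩
    Σ≤ n (λ a → Σ≤ (n ∸ a) (λ b → t a (a ℕ.+ b))) + (Σ≤ n (λ a → t a (suc n)) + t (suc n) (suc n))
      ≈⟨ +-assoc _ _ _ ⟨
    Σ≤ n (λ a → Σ≤ (n ∸ a) (λ b → t a (a ℕ.+ b))) + Σ≤ n (λ a → t a (suc n)) + t (suc n) (suc n)
      ≈⟨ +-congʳ (Σ≤-+ n _ _) ⟨
    Σ≤ n (λ a → Σ≤ (n ∸ a) (λ b → t a (a ℕ.+ b)) + t a (suc n)) + t (suc n) (suc n)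
      ≈⟨ +-cong (Σ≤-cong n row) (reflexive (≡.cong (t (suc n)) (≡.sym (ℕ.+-identityʳ (suc n))))) ⟩
    Σ≤ n (λ a → Σ≤ (suc n ∸ a) (λ b → t a (a ℕ.+ b))) + t (suc n) (suc n ℕ.+ 0)
      ≈⟨ +-congˡ (Σ≤-congʳ (λ b → t (suc n) (suc n ℕ.+ b)) (≡.sym (ℕ.n∸n≡0 n))) ⟩
    Σ≤ (suc n) (λ a → Σ≤ (suc n ∸ a) (λ b → t a (a ℕ.+ b))) ∎
    where
    row : ∀ a → a ≤ n → Σ≤ (n ∸ a) (λ b → t a (a ℕ.+ b)) + t a (suc n) ≈ Σ≤ (suc n ∸ a) (λ b → t a (a ℕ.+ b))
    row a a≤n = sym (trans (Σ≤-congʳ _ (ℕ.+-∸-assoc 1 a≤n))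
      (+-congˡ (reflexive (≡.cong (t a) (≡.trans (ℕ.+-suc a (n ∸ a)) (≡.cong suc (ℕ.m+[n∸m]≡n a≤n)))))))

  geometric-telescope : ∀ y N → (1# - y) * Σ≤ N (y ^_) ≈ 1# - y ^ suc N
  geometric-telescope y zero = base y
    where
    base : ∀ y → (1# - y) * 1# ≈ 1# - y * 1#
    base = solve 1 (λ y → (con (+ 1) :- y) :* con (+ 1) := con (+ 1) :- y :* con (+ 1)) refl
  geometric-telescope y (suc N) = begin
    (1# - y) * (Σ≤ N (y ^_) + y ^ suc N)             ≈⟨ distribˡ (1# - y) _ _ ⟩
    (1# - y) * Σ≤ N (y ^_) + (1# - y) * y ^ suc N    ≈⟨ +-congʳ (geometric-telescope y N) ⟩
    1# - y ^ suc N + (1# - y) * y ^ suc N            ≈⟨ step y (y ^ suc N) ⟩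
    1# - y * y ^ suc N                               ∎
    where
    step : ∀ y w → 1# - w + (1# - y) * w ≈ 1# - y * w
    step = solve 2 (λ y w → let I = con (+ 1) in I :- w :+ (I :- y) :* w := I :- y :* w) refl

module PowerSeries {c ℓ} (𝓡 : CommutativeRing c ℓ) where
  open CommutativeRing 𝓡 hiding (zero)
  open Sum 𝓡
  open import Relation.Binary.Reasoning.Setoid setoid

  PS : Set c
  PS = ℕ → Carrier

  infix 4 _≈ₚ_
  infixl 6 _+ₚ_
  infixl 7 _*ₚ_

  _≈ₚ_ : PS → PS → Set ℓ
  f ≈ₚ g = ∀ i → f i ≈ g i

  _+ₚ_ _*ₚ_ : PS → PS → PS
  (f +ₚ g) i = f i + g i
  (f *ₚ g) i = Σ≤ i (λ a → f a * g (i ∸ a))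

  -ₚ_ : PS → PS
  (-ₚ f) i = - f i

  0ₚ 1ₚ : PS
  0ₚ _ = 0#
  1ₚ zero = 1#
  1ₚ (suc _) = 0#

  *ₚ-cong : ∀ {f f′ g g′} → f ≈ₚ f′ → g ≈ₚ g′ → f *ₚ g ≈ₚ f′ *ₚ g′
  *ₚ-cong f≈f′ g≈g′ i = Σ≤-cong i (λ a _ → *-cong (f≈f′ a) (g≈g′ (i ∸ a)))

  *ₚ-comm : ∀ f g → f *ₚ g ≈ₚ g *ₚ f
  *ₚ-comm f g i = begin
    Σ≤ i (λ a → f a * g (i ∸ a))              ≈⟨ Σ≤-reverse i _ ⟩
    Σ≤ i (λ a → f (i ∸ a) * g (i ∸ (i ∸ a)))
      ≈⟨ Σ≤-cong i (λ a a≤i → trans (*-congˡ (reflexive (≡.cong g (ℕ.m∸[m∸n]≡n a≤i)))) (*-comm _ _)) ⟩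
    Σ≤ i (λ a → g a * f (i ∸ a))              ∎

  *ₚ-assoc : ∀ f g h → (f *ₚ g) *ₚ h ≈ₚ f *ₚ (g *ₚ h)
  *ₚ-assoc f g h i = begin
    Σ≤ i (λ d → Σ≤ d (λ a → f a * g (d ∸ a)) * h (i ∸ d))
      ≈⟨ Σ≤-cong i (λ d _ → Σ≤-*ʳ d _ _) ⟩
    Σ≤ i (λ d → Σ≤ d (λ a → f a * g (d ∸ a) * h (i ∸ d)))
      ≈⟨ Σ≤-triangle i _ ⟩
    Σ≤ i (λ a → Σ≤ (i ∸ a) (λ b → f a * g (a ℕ.+ b ∸ a) * h (i ∸ (a ℕ.+ b))))
      ≈⟨ Σ≤-cong i (λ a _ → Σ≤-cong (i ∸ a) (λ b _ → reindex a b)) ⟩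
    Σ≤ i (λ a → Σ≤ (i ∸ a) (λ b → f a * (g b * h (i ∸ a ∸ b))))
      ≈⟨ Σ≤-cong i (λ a _ → Σ≤-*ˡ (i ∸ a) _ _) ⟨
    Σ≤ i (λ a → f a * Σ≤ (i ∸ a) (λ b → g b * h (i ∸ a ∸ b)))
      ∎
    where
    reindex : ∀ a b → f a * g (a ℕ.+ b ∸ a) * h (i ∸ (a ℕ.+ b)) ≈ f a * (g b * h (i ∸ a ∸ b))
    reindex a b = trans (*-assoc _ _ _)
      (*-congˡ (*-cong (reflexive (≡.cong g (ℕ.m+n∸m≡n a b))) (reflexive (≡.cong h (≡.sym (ℕ.∸-+-assoc i a b))))))

  *ₚ-identityˡ : ∀ f → 1ₚ *ₚ f ≈ₚ f
  *ₚ-identityˡ f zero = *-identityˡ (f 0)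
  *ₚ-identityˡ f (suc n) = begin
    Σ≤ (suc n) (λ a → 1ₚ a * f (suc n ∸ a))         ≈⟨ Σ≤-suc n _ ⟩
    1# * f (suc n) + Σ≤ n (λ a → 0# * f (n ∸ a))    ≈⟨ +-cong (*-identityˡ _) (Σ≤-zero n (λ a _ → zeroˡ _)) ⟩
    f (suc n) + 0#                                  ≈⟨ +-identityʳ _ ⟩
    f (suc n)                                       ∎

  *ₚ-distribˡ : ∀ f g h → f *ₚ (g +ₚ h) ≈ₚ f *ₚ g +ₚ f *ₚ h
  *ₚ-distribˡ f g h i = trans (Σ≤-cong i (λ a _ → distribˡ (f a) _ _)) (Σ≤-+ i _ _)

  commutativeRing : CommutativeRing c ℓ
  commutativeRing = record
    { Carrier = PS ; _≈_ = _≈ₚ_ ; _+_ = _+ₚ_ ; _*_ = _*ₚ_ ; -_ = -ₚ_ ; 0# = 0ₚ ; 1# = 1ₚ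
    ; isCommutativeRing = record
      { isRing = record
        { +-isAbelianGroup = Pointwise.isAbelianGroup +-isAbelianGroup
        ; *-cong = *ₚ-cong
        ; *-assoc = *ₚ-assoc
        ; *-identity = *ₚ-identityˡ , (λ f i → trans (*ₚ-comm f 1ₚ i) (*ₚ-identityˡ f i))
        ; distrib = *ₚ-distribˡ , (λ f g h i → trans (*ₚ-comm (g +ₚ h) f i)
                        (trans (*ₚ-distribˡ f g h i) (+-cong (*ₚ-comm f g i) (*ₚ-comm f h i)))) }
      ; *-comm = *ₚ-comm } }

  Σ≤-coefficient : ∀ n F i → Sum.Σ≤ commutativeRing n F i ≈ Σ≤ n (λ k → F k i)
  Σ≤-coefficient zero F i = refl
  Σ≤-coefficient (suc n) F i = +-congʳ (Σ≤-coefficient n F i)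

module _ {c ℓ} (𝓡 : CommutativeRing c ℓ) where
  open CommutativeRing 𝓡

  withMultiplication : (_∙_ : Op₂ Carrier) (e : Carrier) → (∀ a b → a ∙ b ≈ a * b) → e ≈ 1# → CommutativeRing c ℓ
  withMultiplication _∙_ e ∙≈* e≈1 = record
    { Carrier = Carrier ; _≈_ = _≈_ ; _+_ = _+_ ; _*_ = _∙_ ; -_ = -_ ; 0# = 0# ; 1# = e
    ; isCommutativeRing = record
      { isRing = record
        { +-isAbelianGroup = +-isAbelianGroup
        ; *-cong = λ {a} {a′} {b} {b′} a≈a′ b≈b′ →
                     trans (∙≈* a b) (trans (*-cong a≈a′ b≈b′) (sym (∙≈* a′ b′)))
        ; *-assoc = λ a b c → trans (∙≈* (a ∙ b) c) (trans (*-congʳ (∙≈* a b)) (trans (*-assoc a b c)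
                      (sym (trans (∙≈* a (b ∙ c)) (*-congˡ (∙≈* b c))))))
        ; *-identity = (λ a → trans (∙≈* e a) (trans (*-congʳ e≈1) (*-identityˡ a)))
                     , (λ a → trans (∙≈* a e) (trans (*-congˡ e≈1) (*-identityʳ a)))
        ; distrib = (λ a b c → trans (∙≈* a (b + c)) (trans (distribˡ a b c) (sym (+-cong (∙≈* a b) (∙≈* a c)))))
                  , (λ a b c → trans (∙≈* (b + c) a) (trans (distribʳ a b c) (sym (+-cong (∙≈* b a) (∙≈* c a)))))
        }
      ; *-comm = λ a b → trans (∙≈* a b) (trans (*-comm a b) (sym (∙≈* b a)))
      }
    }

  Σ≤-withMultiplication : ∀ {_∙_ e} ∙≈* e≈1 n F →
    Sum.Σ≤ (withMultiplication _∙_ e ∙≈* e≈1) n F ≈ Sum.Σ≤ 𝓡 n F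
  Σ≤-withMultiplication ∙≈* e≈1 zero F = refl
  Σ≤-withMultiplication ∙≈* e≈1 (suc n) F = +-congʳ (Σ≤-withMultiplication ∙≈* e≈1 n F)

module Recursion {c ℓ} (𝓡 : CommutativeRing c ℓ) where
  open CommutativeRing 𝓡 hiding (zero)
  open RingSolver 𝓡
  open import Algebra.Definitions _≈_ using (RightInvertible)
  open import Algebra.Definitions.RawSemiring (Semiring.rawSemiring semiring) using (_^_)
  open import Algebra.Properties.Group +-group using (x∙y⁻¹≈ε⇒x≈y; x≈y⇒x∙y⁻¹≈ε)
  open import Algebra.Properties.Semiring.Exp semiring using (^-homo-*)
  open import Relation.Binary.Reasoning.Setoid setoid

  Unit : Carrier → Set (c ⊔ ℓ)
  Unit = RightInvertible 1# _*_

  unit-* : ∀ {a b} → Unit a → Unit b → Unit (a * b)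
  unit-* {a} {b} (a⁻¹ , aa⁻¹≈1) (b⁻¹ , bb⁻¹≈1) = a⁻¹ * b⁻¹ , (begin
    a * b * (a⁻¹ * b⁻¹)    ≈⟨ regroup a b a⁻¹ b⁻¹ ⟩
    a * a⁻¹ * (b * b⁻¹)    ≈⟨ *-cong aa⁻¹≈1 bb⁻¹≈1 ⟩
    1# * 1#                ≈⟨ *-identityˡ 1# ⟩
    1#                     ∎)
    where
    regroup : ∀ a b c d → a * b * (c * d) ≈ a * c * (b * d)
    regroup = solve 4 (λ a b c d → a :* b :* (c :* d) := a :* c :* (b :* d)) refl

  unit-cancel : ∀ {a b} → Unit a → a * b ≈ 0# → b ≈ 0#
  unit-cancel {a} {b} (a⁻¹ , aa⁻¹≈1) ab≈0 = begin
    b                 ≈⟨ *-identityˡ b ⟨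
    1# * b            ≈⟨ *-congʳ aa⁻¹≈1 ⟨
    a * a⁻¹ * b       ≈⟨ regroup a a⁻¹ b ⟩
    a⁻¹ * (a * b)     ≈⟨ *-congˡ ab≈0 ⟩
    a⁻¹ * 0#          ≈⟨ zeroʳ a⁻¹ ⟩
    0#                ∎
    where
    regroup : ∀ a c b → a * c * b ≈ c * (a * b)
    regroup = solve 3 (λ a c b → a :* c :* b := c :* (a :* b)) refl

  factor : Carrier → Carrier → ℕ → Carrier
  factor x z k = 1# - z * x ^ k

  denominator : Carrier → Carrier → Carrier
  denominator x z = factor x z 1 * factor x z 2 * factor x z 3 * factor x z 4 * factor x z 5

  square1+ : Carrier → Carrier
  square1+ x = (1# + x) * (1# + x)

  keyPolynomial : Carrier → Carrier → Carrier
  keyPolynomial x z = square1+ x * (p 1 * p 1 * p 3 * p 5 * p 5 - denominator x z)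
       + x * ((1# + 1#) * denominator x z - p 1 * p 1 * p 2 * p 5 * p 6 - p 0 * p 1 * p 4 * p 5 * p 5)
    where p = factor x z

  keyPolynomial≈0 : ∀ x z → keyPolynomial x z ≈ 0#
  keyPolynomial≈0 = solve 2 (λ x z →
    let I = con (+ 1)
        p = λ k → I :- z :* x :^ k
        D = p 1 :* p 2 :* p 3 :* p 4 :* p 5
    in (I :+ x) :* (I :+ x) :* (p 1 :* p 1 :* p 3 :* p 5 :* p 5 :- D)
       :+ x :* ((I :+ I) :* D :- p 1 :* p 1 :* p 2 :* p 5 :* p 6 :- p 0 :* p 1 :* p 4 :* p 5 :* p 5) := con (+ 0)) refl

  -- IsRatio R x y t says t = R (1 - y) (1 - y x⁴) / ((1 - y x) (1 - y x³)); for
  -- y = x ^ (n + 1) this is the paper's R_n.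
  IsRatio : (R x y t : Carrier) → Set ℓ
  IsRatio R x y t = factor x y 1 * factor x y 3 * t ≈ R * (1# - y) * factor x y 4

  ratioDefect : (R x y t : Carrier) → Carrier
  ratioDefect R x y t = factor x y 1 * factor x y 3 * t - R * (1# - y) * factor x y 4

  -- An ideal-membership certificate: every summand on the right vanishes under the
  -- hypotheses of ratio-recursion.
  recursion-defect : ∀ u R x z t0 t1 t2 →
    let p = factor x z
        D = denominator x z
        W = square1+ x
    in D * W * (t1 - (1# + u * t1 * (t2 + t0)))
       ≈ R * keyPolynomial x z
         + W * p 1 * p 3 * p 5 * (1# - u * (t2 + t0)) * ratioDefect R x (x * z) t1
         - u * W * R * p 1 * p 5 * (p 1 * ratioDefect R x (x * (x * z)) t2 + p 5 * ratioDefect R x z t0)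
         + W * D * (R - (1# + (1# + 1#) * u * R * R))
         - R * ((1# + 1#) * D - p 1 * p 1 * p 2 * p 5 * p 6 - p 0 * p 1 * p 4 * p 5 * p 5) * (x - u * R * W)
  recursion-defect = solve 7 (λ u R x z t0 t1 t2 →
    let I = con (+ 1)
        p = λ k → I :- z :* x :^ k
        D = p 1 :* p 2 :* p 3 :* p 4 :* p 5
        W = (I :+ x) :* (I :+ x)
        P = W :* (p 1 :* p 1 :* p 3 :* p 5 :* p 5 :- D)
            :+ x :* ((I :+ I) :* D :- p 1 :* p 1 :* p 2 :* p 5 :* p 6 :- p 0 :* p 1 :* p 4 :* p 5 :* p 5)
        e = λ y t → (I :- y :* x :^ 1) :* (I :- y :* x :^ 3) :* t :- R :* (I :- y) :* (I :- y :* x :^ 4)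
    in D :* W :* (t1 :- (I :+ u :* t1 :* (t2 :+ t0)))
       := R :* P
         :+ W :* p 1 :* p 3 :* p 5 :* (I :- u :* (t2 :+ t0)) :* e (x :* z) t1
         :- u :* W :* R :* p 1 :* p 5 :* (p 1 :* e (x :* (x :* z)) t2 :+ p 5 :* e z t0)
         :+ W :* D :* (R :- (I :+ (I :+ I) :* u :* R :* R))
         :- R :* ((I :+ I) :* D :- p 1 :* p 1 :* p 2 :* p 5 :* p 6 :- p 0 :* p 1 :* p 4 :* p 5 :* p 5) :* (x :- u :* R :* W)) refl

  ratio-recursion : ∀ {u R x z t0 t1 t2} →
    R ≈ 1# + (1# + 1#) * u * R * R →
    x ≈ u * R * square1+ x →
    IsRatio R x z t0 → IsRatio R x (x * z) t1 → IsRatio R x (x * (x * z)) t2 →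
    Unit (denominator x z * square1+ x) →
    t1 ≈ 1# + u * t1 * (t2 + t0)
  ratio-recursion {u} {R} {x} {z} {t0} {t1} {t2} R-eq x-eq ratio0 ratio1 ratio2 unit =
    x∙y⁻¹≈ε⇒x≈y t1 _ (unit-cancel unit (begin
      denominator x z * square1+ x * (t1 - (1# + u * t1 * (t2 + t0)))
        ≈⟨ recursion-defect u R x z t0 t1 t2 ⟩
      _ ≈⟨ +-cong (+-cong (+-cong (+-cong (*-congˡ (keyPolynomial≈0 x z)) (*-congˡ (x≈y⇒x∙y⁻¹≈ε ratio1)))
                                  (-‿cong (*-congˡ (+-cong (*-congˡ (x≈y⇒x∙y⁻¹≈ε ratio2))
                                                           (*-congˡ (x≈y⇒x∙y⁻¹≈ε ratio0))))))
                          (*-congˡ (x≈y⇒x∙y⁻¹≈ε R-eq)))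
                  (-‿cong (*-congˡ (x≈y⇒x∙y⁻¹≈ε x-eq))) ⟩
      _ ≈⟨ combination-of-zeros _ _ _ _ _ _ _ ⟩
      0# ∎))
    where
    combination-of-zeros : ∀ a b c d e f g → a * 0# + b * 0# - c * (d * 0# + e * 0#) + f * 0# - g * 0# ≈ 0#
    combination-of-zeros = solve 7 (λ a b c d e f g → let O = con (+ 0) in
      a :* O :+ b :* O :- c :* (d :* O :+ e :* O) :+ f :* O :- g :* O := O) refl

  module RatioSequence {u R x : Carrier} {w S : ℕ → Carrier}
    (R-eq : R ≈ 1# + (1# + 1#) * u * R * R)
    (x-eq : x ≈ u * R * square1+ x)
    (w-inverse : ∀ k → (1# - x ^ suc k) * w (suc k) ≈ 1#)
    (S-def : ∀ a → S a ≈ R * (1# - x ^ a) * (1# - x ^ (a ℕ.+ 4)) * w (a ℕ.+ 1) * w (a ℕ.+ 3))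
    where

    factor-split : ∀ a k → 1# - x ^ (a ℕ.+ k) ≈ factor x (x ^ a) k
    factor-split a k = +-congˡ (-‿cong (^-homo-* x a k))

    factor-inverse : ∀ a k → factor x (x ^ a) (suc k) * w (a ℕ.+ suc k) ≈ 1#
    factor-inverse a k = trans (*-congʳ (sym (factor-split a (suc k)))) (w-inverse′ (ℕ.+-suc a k))
      where
      w-inverse′ : ∀ {m} → m ≡ suc (a ℕ.+ k) → (1# - x ^ m) * w m ≈ 1#
      w-inverse′ ≡.refl = w-inverse (a ℕ.+ k)

    S-ratio : ∀ a → IsRatio R x (x ^ a) (S a)
    S-ratio a = begin
      f 1 * f 3 * S a                                        ≈⟨ *-congˡ (S-def a) ⟩
      f 1 * f 3 * (Q * w (a ℕ.+ 1) * w (a ℕ.+ 3))            ≈⟨ regroup (f 1) (f 3) Q (w (a ℕ.+ 1)) (w (a ℕ.+ 3)) ⟩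
      f 1 * w (a ℕ.+ 1) * (f 3 * w (a ℕ.+ 3)) * Q            ≈⟨ *-congʳ (*-cong (factor-inverse a 0) (factor-inverse a 2)) ⟩
      1# * 1# * Q                                            ≈⟨ trans (*-congʳ (*-identityˡ 1#)) (*-identityˡ Q) ⟩
      R * (1# - x ^ a) * (1# - x ^ (a ℕ.+ 4))                ≈⟨ *-congˡ (factor-split a 4) ⟩
      R * (1# - x ^ a) * f 4                                 ∎
      where
      f = factor x (x ^ a)
      Q = R * (1# - x ^ a) * (1# - x ^ (a ℕ.+ 4))
      regroup : ∀ a b q c d → a * b * (q * c * d) ≈ a * c * (b * d) * q
      regroup = solve 5 (λ a b q c d → a :* b :* (q :* c :* d) := a :* c :* (b :* d) :* q) refl

    1+x-unit : Unit (1# + x)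
    1+x-unit = (1# - x) * w 2 , trans (difference-of-squares x (w 2)) (w-inverse 1)
      where
      difference-of-squares : ∀ x c → (1# + x) * ((1# - x) * c) ≈ (1# - x ^ 2) * c
      difference-of-squares = solve 2 (λ x c → let I = con (+ 1) in
        (I :+ x) :* ((I :- x) :* c) := (I :- x :^ 2) :* c) refl

    denominator-unit : ∀ n → Unit (denominator x (x ^ n) * square1+ x)
    denominator-unit n =
      unit-* (unit-* (unit-* (unit-* (unit-* (f⁻¹ 0) (f⁻¹ 1)) (f⁻¹ 2)) (f⁻¹ 3)) (f⁻¹ 4)) (unit-* 1+x-unit 1+x-unit)
      where
      f⁻¹ : ∀ k → Unit (factor x (x ^ n) (suc k))
      f⁻¹ k = w (n ℕ.+ suc k) , factor-inverse n k

    recursion : ∀ n → S (suc n) ≈ 1# + u * S (suc n) * (S (suc (suc n)) + S n)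
    recursion n =
      ratio-recursion R-eq x-eq (S-ratio n) (S-ratio (suc n)) (S-ratio (suc (suc n))) (denominator-unit n)

ℚ-ring : CommutativeRing 0ℓ 0ℓ
ℚ-ring = ℚ.+-*-commutativeRing

module ℚ[[g]] = PowerSeries ℚ-ring
module ℚ[[g,g̃]] = PowerSeries ℚ[[g]].commutativeRing
open Sum ℚ-ring using (Σ≤; Σ≤-cong; Σ≤-zero; Σ≤-extend)

sumTo≡Σ≤ : ∀ n f → sumTo n f ≡ Σ≤ n f
sumTo≡Σ≤ zero f = ≡.refl
sumTo≡Σ≤ (suc n) f = ≡.cong (ℚ._+ f (suc n)) (sumTo≡Σ≤ n f)

sumTo-cong : ∀ n {f g} → (∀ k → k ≤ n → f k ≡ g k) → sumTo n f ≡ sumTo n g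
sumTo-cong n {f} {g} f≡g = ≡.trans (sumTo≡Σ≤ n f) (≡.trans (Σ≤-cong n f≡g) (≡.sym (sumTo≡Σ≤ n g)))

sumTo-zero : ∀ n {f} → (∀ k → k ≤ n → f k ≡ 0ℚ) → sumTo n f ≡ 0ℚ
sumTo-zero n {f} f≡0 = ≡.trans (sumTo≡Σ≤ n f) (Σ≤-zero n f≡0)

⊛≋*ₚ : ∀ f h → f ⊛ h ≋ f ℚ[[g,g̃]].*ₚ h
⊛≋*ₚ f h i j = ≡.sym (begin
  Sum.Σ≤ ℚ[[g]].commutativeRing i (λ a → f a ℚ[[g]].*ₚ h (i ∸ a)) j
    ≡⟨ ℚ[[g]].Σ≤-coefficient i _ j ⟩
  Σ≤ i (λ a → Σ≤ j (λ b → f a b ℚ.* h (i ∸ a) (j ∸ b)))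
    ≡⟨ Σ≤-cong i (λ a _ → ≡.sym (sumTo≡Σ≤ j _)) ⟩
  Σ≤ i (λ a → sumTo j (λ b → f a b ℚ.* h (i ∸ a) (j ∸ b)))
    ≡⟨ sumTo≡Σ≤ i _ ⟨
  (f ⊛ h) i j ∎)
  where open ≡.≡-Reasoning

𝟙≋1ₚ : 𝟙 ≋ ℚ[[g,g̃]].1ₚ
𝟙≋1ₚ zero zero = ≡.refl
𝟙≋1ₚ zero (suc j) = ≡.refl
𝟙≋1ₚ (suc i) j = ≡.refl

series : CommutativeRing 0ℓ 0ℓ
series = withMultiplication ℚ[[g,g̃]].commutativeRing _⊛_ 𝟙 ⊛≋*ₚ 𝟙≋1ₚ

module 𝕊 = CommutativeRing series
open import Algebra.Definitions.RawSemiring (Semiring.rawSemiring 𝕊.semiring) using (_^_)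

^ₛ≋^ : ∀ x n → x ^ₛ n ≋ x ^ n
^ₛ≋^ x zero = 𝕊.refl
^ₛ≋^ x (suc n) = 𝕊.*-congˡ {x} (^ₛ≋^ x n)

-- Proved through the generic lemmas: a direct induction makes Agda unfold ℚ addition
-- in the conversion check, which is very slow.
Σ≤-coefficient : ∀ N F i j → Sum.Σ≤ series N F i j ≡ sumTo N (λ m → F m i j)
Σ≤-coefficient N F i j = ≡.trans (Σ≤-withMultiplication ℚ[[g,g̃]].commutativeRing ⊛≋*ₚ 𝟙≋1ₚ N F i j)
  (≡.trans (ℚ[[g,g̃]].Σ≤-coefficient N F i j)
    (≡.trans (ℚ[[g]].Σ≤-coefficient N (λ m → F m i) j) (≡.sym (sumTo≡Σ≤ N _))))

^-vanishes : ∀ {y} → y 0 0 ≡ 0ℚ → ∀ m {i j} → i ℕ.+ j < m → (y ^ m) i j ≡ 0ℚ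
^-vanishes {y} y₀₀≡0 (suc m) {i} {j} (s≤s i+j≤m) =
  sumTo-zero i (λ a a≤i → sumTo-zero j (λ b b≤j → term a b a≤i b≤j))
  where
  open import Algebra.Properties.CommutativeSemigroup ℕ.+-commutativeSemigroup using (interchange)
  lower : ∀ {a b} → a ≤ i → b ≤ j → 0 < a ℕ.+ b → (i ∸ a) ℕ.+ (j ∸ b) < m
  lower {a} {b} a≤i b≤j a+b>0 = ℕ.<-≤-trans (ℕ.m<m+n _ a+b>0) (ℕ.≤-trans (ℕ.≤-reflexive
    (≡.trans (interchange (i ∸ a) (j ∸ b) a b) (≡.cong₂ ℕ._+_ (ℕ.m∸n+n≡m a≤i) (ℕ.m∸n+n≡m b≤j)))) i+j≤m)
  term : ∀ a b → a ≤ i → b ≤ j → y a b ℚ.* (y ^ m) (i ∸ a) (j ∸ b) ≡ 0ℚ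
  term zero zero _ _ = ≡.trans (≡.cong (ℚ._* (y ^ m) i j) y₀₀≡0) (ℚ.*-zeroˡ ((y ^ m) i j))
  term zero (suc b) a≤i b≤j =
    ≡.trans (≡.cong (y 0 (suc b) ℚ.*_) (^-vanishes y₀₀≡0 m (lower a≤i b≤j (s≤s z≤n)))) (ℚ.*-zeroʳ (y 0 (suc b)))
  term (suc a) b a≤i b≤j =
    ≡.trans (≡.cong (y (suc a) b ℚ.*_) (^-vanishes y₀₀≡0 m (lower a≤i b≤j (s≤s z≤n)))) (ℚ.*-zeroʳ (y (suc a) b))

invOneMinus-geometric : ∀ {y} → y 0 0 ≡ 0ℚ → ∀ {N i j} → i ℕ.+ j ≤ N →
                        invOneMinus y i j ≡ Sum.Σ≤ series N (y ^_) i j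
invOneMinus-geometric {y} y₀₀≡0 {N} {i} {j} i+j≤N = begin
  sumTo (i ℕ.+ j) (λ m → (y ^ₛ m) i j)   ≡⟨ sumTo-cong (i ℕ.+ j) (λ m _ → ^ₛ≋^ y m i j) ⟩
  sumTo (i ℕ.+ j) (λ m → (y ^ m) i j)    ≡⟨ sumTo≡Σ≤ (i ℕ.+ j) _ ⟩
  Σ≤ (i ℕ.+ j) (λ m → (y ^ m) i j)       ≡⟨ Σ≤-extend N i+j≤N (λ m i+j<m _ → ^-vanishes y₀₀≡0 m i+j<m) ⟨
  Σ≤ N (λ m → (y ^ m) i j)               ≡⟨ sumTo≡Σ≤ N _ ⟨
  sumTo N (λ m → (y ^ m) i j)            ≡⟨ Σ≤-coefficient N (y ^_) i j ⟨
  Sum.Σ≤ series N (y ^_) i j             ∎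
  where open ≡.≡-Reasoning

invOneMinus-inverse : ∀ {y} → y 0 0 ≡ 0ℚ → (𝟙 ⊖ y) ⊛ invOneMinus y ≋ 𝟙
invOneMinus-inverse {y} y₀₀≡0 i j = begin
  ((𝟙 ⊖ y) ⊛ invOneMinus y) i j
    ≡⟨ sumTo-cong i (λ a _ → sumTo-cong j (λ b _ → ≡.cong ((𝟙 ⊖ y) a b ℚ.*_)
         (invOneMinus-geometric y₀₀≡0 (ℕ.+-mono-≤ (ℕ.m∸n≤m i a) (ℕ.m∸n≤m j b))))) ⟩
  ((𝟙 ⊖ y) ⊛ Sum.Σ≤ series (i ℕ.+ j) (y ^_)) i j
    ≡⟨ Sum.geometric-telescope series y (i ℕ.+ j) i j ⟩
  𝟙 i j ℚ.- (y ^ suc (i ℕ.+ j)) i j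
    ≡⟨ ≡.cong (λ c → 𝟙 i j ℚ.- c) (^-vanishes {y} y₀₀≡0 (suc (i ℕ.+ j)) {i} {j} ℕ.≤-refl) ⟩
  𝟙 i j ℚ.- 0ℚ
    ≡⟨ ℚ.+-identityʳ (𝟙 i j) ⟩
  𝟙 i j
    ∎
  where open ≡.≡-Reasoning

const-two : const two ≋ 𝟙 ⊕ 𝟙
const-two zero zero = ≡.refl
const-two zero (suc j) = ≡.sym (ℚ.+-identityʳ 0ℚ)
const-two (suc i) j = ≡.sym (ℚ.+-identityʳ 0ℚ)

mainTheorem2 : (R x : Series) →
    R 0 0 ≡ 1ℚ →
    R ≋ 𝟙 ⊕ const two ⊛ ggt ⊛ R ⊛ R →
    x 0 0 ≡ 0ℚ →
    x ≋ ggt ⊛ R ⊛ ((𝟙 ⊕ x) ⊛ (𝟙 ⊕ x)) →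
    -- Rsh R x (suc n) = R_n, Rsh R x n = R_{n-1}
    (n : ℕ) →
    Rsh R x (suc n) ≋ 𝟙 ⊕ ggt ⊛ Rsh R x (suc n) ⊛ (Rsh R x (suc (suc n)) ⊕ Rsh R x n)
mainTheorem2 R x _ R-eq x₀₀≡0 x-eq = recursion
  where
  open 𝕊
  open Recursion series using (module RatioSequence)

  w : ℕ → Series
  w k = invOneMinus (x ^ₛ k)

  1-^ₛ≋1-^ : ∀ k → 𝟙 ⊖ x ^ₛ k ≋ 𝟙 ⊖ x ^ k
  1-^ₛ≋1-^ k = +-congˡ {𝟙} (-‿cong (^ₛ≋^ x k))

  R-eq′ : R ≋ 𝟙 ⊕ (𝟙 ⊕ 𝟙) ⊛ ggt ⊛ R ⊛ R
  R-eq′ = trans R-eq (+-congˡ {𝟙} (*-congʳ {R} (*-congʳ {R} (*-congʳ {ggt} const-two))))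

  w-inverse : ∀ k → (𝟙 ⊖ x ^ suc k) ⊛ w (suc k) ≋ 𝟙
  w-inverse k = trans (*-congʳ {w (suc k)} (sym (1-^ₛ≋1-^ (suc k))))
    (invOneMinus-inverse {x ^ₛ suc k} (≡.trans (^ₛ≋^ x (suc k) 0 0) (^-vanishes {x} x₀₀≡0 (suc k) {0} {0} (s≤s z≤n))))

  Rsh-def : ∀ a → Rsh R x a ≋ R ⊛ (𝟙 ⊖ x ^ a) ⊛ (𝟙 ⊖ x ^ (a ℕ.+ 4)) ⊛ w (a ℕ.+ 1) ⊛ w (a ℕ.+ 3)
  Rsh-def a = *-congʳ {w (a ℕ.+ 3)} (*-congʳ {w (a ℕ.+ 1)} (*-cong (*-congˡ {R} (1-^ₛ≋1-^ a)) (1-^ₛ≋1-^ (a ℕ.+ 4))))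

  open RatioSequence {ggt} {R} {x} {w} {Rsh R x} R-eq′ x-eq w-inverse Rsh-def
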